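{- Let $n$ be a positive integer and $b>1$ an integer. There exists an integer $c$ with $0\le c\le b-1$ such that $2^n=(1,c,1)_b$ (i.e. $2^n=1+cb+b^2$) and this representation is not of binomial form (i.e. it is not the case that $c=2$) if and only if both of the following hold: (1) there is a factorization $2^n-1=kb$ with $k$ an integer satisfying $b\le k\le 2b-1$; and (2) it is not the case that $n$ is even and $b=2^{n/2}-1$.
   Context: For an integer $b>1$, $(c_m,\ldots,c_0)_b$ denotes $\sum_{i=0}^m c_i b^i$ with integer digits $0\le c_i<b$, $c_m>0$. A representation has binomial form if its digits are $\alpha\binom{m}{m},\ldots,\alpha\binom{m}{0}$ for a positive integer $\alpha$; a 3-digit representation $(1,c,1)_b$ has binomial form exactly when it equals $(1,2,1)_b$. -}

module Defs where

open import Data.Nat using (ℕ; _+_; _*_; _^_)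
open import Relation.Binary.PropositionalEquality using (_≡_)

digits3 : ℕ → ℕ → ℕ
digits3 b c = 1 + c * b + b ^ 2

-- (1,c,1)_b has binomial form  α·C(2,2), α·C(2,1), α·C(2,0) ; with leading digit 1
-- this means α = 1, i.e. c = 2 (as stated in the paper's context)
BinomialForm3 : ℕ → Set
BinomialForm3 c = c ≡ 2

-- Since 1 + c b + b² = 1 + (c + b) b, the digit c of a representation 2ⁿ = (1,c,1)_b
-- corresponds to the factor k = c + b of 2ⁿ - 1 = k b, and 0 ≤ c ≤ b - 1 becomes
-- b ≤ k ≤ 2b - 1.  The binomial form c = 2 means 2ⁿ = (b + 1)², and a square is a
-- power of two only if it is an even power 2^(2m) of two, i.e. b = 2^m - 1.
module Submission where

open import Defs
open import Data.Nat using (ℕ; zero; suc; _+_; _*_; _^_; _∸_; _≤_; _<_; s≤s; NonZero)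
open import Data.Nat.Properties
open import Data.Nat.Divisibility using (_∣_; divides; ∣⇒≤)
open import Data.Nat.Primality using (euclidsLemma; prime[2])
open import Data.Nat.Tactic.RingSolver using (solve-∀)
open import Data.Empty using (⊥-elim)
open import Data.Product using (Σ; ∃-syntax; _×_; _,_)
open import Data.Sum using (reduce)
open import Function using (_∘_)
open import Function.Bundles using (_⇔_; mk⇔; Equivalence)
open import Relation.Binary.PropositionalEquality
open import Relation.Nullary using (¬_)

open Equivalence using (to; from)

-- b ^ 2 unfolds to b * (b * 1); the ring solver needs that form spelled out.
digits3≡1+[c+b]*b : ∀ b c → digits3 b c ≡ 1 + (c + b) * b
digits3≡1+[c+b]*b = identity
  where
  identity : ∀ b c → 1 + c * b + b * (b * 1) ≡ 1 + (c + b) * b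
  identity = solve-∀

digits3[2]≡[1+b]² : ∀ b → digits3 b 2 ≡ suc b * suc b
digits3[2]≡[1+b]² b = trans (digits3≡1+[c+b]*b b 2) (identity b)
  where
  identity : ∀ b → 1 + (2 + b) * b ≡ suc b * suc b
  identity = solve-∀

digits3-injective : ∀ b .{{_ : NonZero b}} {c c′} → digits3 b c ≡ digits3 b c′ → c ≡ c′
digits3-injective b {c} {c′} eq =
  *-cancelʳ-≡ c c′ b (+-cancelˡ-≡ 1 _ _ (+-cancelʳ-≡ (b ^ 2) _ _ eq))

c≤b⇔c+[1+b]≤2*[1+b]∸1 : ∀ b c → c ≤ b ⇔ c + suc b ≤ 2 * suc b ∸ 1
c≤b⇔c+[1+b]≤2*[1+b]∸1 b c = mk⇔
  (λ c≤b → subst (c + suc b ≤_) (sym 2*[1+b]∸1≡b+[1+b]) (+-monoˡ-≤ (suc b) c≤b))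
  (λ c+[1+b]≤ → +-cancelʳ-≤ (suc b) c b (subst (c + suc b ≤_) 2*[1+b]∸1≡b+[1+b] c+[1+b]≤))
  where
  2*[1+b]∸1≡b+[1+b] : 2 * suc b ∸ 1 ≡ b + suc b
  2*[1+b]∸1≡b+[1+b] = cong (b +_) (+-identityʳ (suc b))

2^n≡1+[2^n∸1] : ∀ n → 2 ^ n ≡ 1 + (2 ^ n ∸ 1)
2^n≡1+[2^n∸1] n = sym (m+[n∸m]≡n (m^n>0 2 n))

2^n≡digits3⇔2^n∸1≡[c+b]*b : ∀ n b c → 2 ^ n ≡ digits3 b c ⇔ 2 ^ n ∸ 1 ≡ (c + b) * b
2^n≡digits3⇔2^n∸1≡[c+b]*b n b c = mk⇔
  (λ 2^n≡digits3 → cong (_∸ 1) (trans 2^n≡digits3 (digits3≡1+[c+b]*b b c)))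
  (λ 2^n∸1≡[c+b]*b →
    trans (2^n≡1+[2^n∸1] n) (trans (cong suc 2^n∸1≡[c+b]*b) (sym (digits3≡1+[c+b]*b b c))))

2^[2*m]≡2^m*2^m : ∀ m → 2 ^ (2 * m) ≡ 2 ^ m * 2 ^ m
2^[2*m]≡2^m*2^m m = trans (cong (2 ^_) (cong (m +_) (+-identityʳ m))) (^-distribˡ-+-* 2 m m)

2∣x*x⇒2∣x : ∀ {x} → 2 ∣ x * x → 2 ∣ x
2∣x*x⇒2∣x {x} = reduce ∘ euclidsLemma x x prime[2]

[y*2]²≡4*y² : ∀ y → y * 2 * (y * 2) ≡ 4 * (y * y)
[y*2]²≡4*y² = solve-∀

x*x≡2^n⇒n≡2*m : ∀ n x → x * x ≡ 2 ^ n → ∃[ m ] n ≡ 2 * m × x ≡ 2 ^ m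
x*x≡2^n⇒n≡2*m zero x x*x≡1 = 0 , refl , m*n≡1⇒n≡1 x x x*x≡1
x*x≡2^n⇒n≡2*m (suc n) x x*x≡2^[1+n]
  with 2∣x*x⇒2∣x {x} (divides (2 ^ n) (trans x*x≡2^[1+n] (*-comm 2 (2 ^ n))))
x*x≡2^n⇒n≡2*m (suc zero) .(y * 2) [y*2]²≡2 | divides y refl =
  ⊥-elim (4≰2 (∣⇒≤ (divides (y * y) (trans (sym [y*2]²≡2) (trans ([y*2]²≡4*y² y) (*-comm 4 (y * y)))))))
  where
  4≰2 : ¬ 4 ≤ 2
  4≰2 (s≤s (s≤s ()))
x*x≡2^n⇒n≡2*m (suc (suc n)) .(y * 2) [y*2]²≡2^[2+n] | divides y refl
  with x*x≡2^n⇒n≡2*m n y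
         (*-cancelˡ-≡ (y * y) (2 ^ n) 4
           (trans (sym ([y*2]²≡4*y² y)) (trans [y*2]²≡2^[2+n] (sym (*-assoc 2 2 (2 ^ n))))))
... | m , refl , refl = suc m , sym (*-suc 2 m) , *-comm (2 ^ m) 2

binomialForm3⇔n≡2*m×b≡2^m∸1 : ∀ n b .{{_ : NonZero b}} c → 2 ^ n ≡ digits3 b c →
  BinomialForm3 c ⇔ (∃[ m ] n ≡ 2 * m × b ≡ 2 ^ m ∸ 1)
binomialForm3⇔n≡2*m×b≡2^m∸1 n b c 2^n≡digits3 = mk⇔ binomial⇒ ⇒binomial
  where
  binomial⇒ : BinomialForm3 c → ∃[ m ] n ≡ 2 * m × b ≡ 2 ^ m ∸ 1
  binomial⇒ refl with x*x≡2^n⇒n≡2*m n (suc b) (sym (trans 2^n≡digits3 (digits3[2]≡[1+b]² b)))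
  ... | m , n≡2*m , 1+b≡2^m = m , n≡2*m , cong (_∸ 1) 1+b≡2^m

  ⇒binomial : (∃[ m ] n ≡ 2 * m × b ≡ 2 ^ m ∸ 1) → BinomialForm3 c
  ⇒binomial (m , refl , b≡2^m∸1) = digits3-injective b (begin
    digits3 b c     ≡⟨ sym 2^n≡digits3 ⟩
    2 ^ (2 * m)     ≡⟨ 2^[2*m]≡2^m*2^m m ⟩
    2 ^ m * 2 ^ m   ≡⟨ cong (λ x → x * x) (trans (2^n≡1+[2^n∸1] m) (cong suc (sym b≡2^m∸1))) ⟩
    suc b * suc b   ≡⟨ sym (digits3[2]≡[1+b]² b) ⟩
    digits3 b 2     ∎)
    where open ≡-Reasoning

theorem2p3 : (n b : ℕ) → 1 ≤ n → 1 < b →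
    (Σ ℕ (λ c → c ≤ b ∸ 1 × 2 ^ n ≡ digits3 b c × ¬ BinomialForm3 c))
    ⇔ ((Σ ℕ (λ k → 2 ^ n ∸ 1 ≡ k * b × b ≤ k × k ≤ 2 * b ∸ 1))
    × ¬ (Σ ℕ (λ m → n ≡ 2 * m × b ≡ 2 ^ m ∸ 1)))
theorem2p3 n (suc b) _ _ = mk⇔
  (λ (c , c≤b , 2^n≡digits3 , ¬binomial) →
    ( c + suc b
    , to (2^n≡digits3⇔2^n∸1≡[c+b]*b n (suc b) c) 2^n≡digits3
    , m≤n+m (suc b) c
    , to (c≤b⇔c+[1+b]≤2*[1+b]∸1 b c) c≤b )
    , ¬binomial ∘ from (binomialForm3⇔n≡2*m×b≡2^m∸1 n (suc b) c 2^n≡digits3))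
  (λ ((k , 2^n∸1≡k*b , b≤k , k≤) , ¬even) →
    let c = k ∸ suc b
        k≡c+b = sym (m∸n+n≡m b≤k)
        2^n≡digits3 = from (2^n≡digits3⇔2^n∸1≡[c+b]*b n (suc b) c)
                        (subst (λ k → 2 ^ n ∸ 1 ≡ k * suc b) k≡c+b 2^n∸1≡k*b)
    in c
     , from (c≤b⇔c+[1+b]≤2*[1+b]∸1 b c) (subst (_≤ 2 * suc b ∸ 1) k≡c+b k≤)
     , 2^n≡digits3
     , ¬even ∘ to (binomialForm3⇔n≡2*m×b≡2^m∸1 n (suc b) c 2^n≡digits3))
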